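{- Let $k>2$ be even. Every $2$-regular $k$-uniform hypergraph $G$ with $n$ vertices and $m$ edges (so $n=km/2$) is isomorphic to a hypergraph obtained by the following construction. For $t\in[m]$ let $V_t=\{\tfrac{k}{2}(t-1)+1,\dots,\tfrac{k}{2}t\}\subseteq[n]$. Let $K_{n,n}$ be the complete bipartite graph with parts $U_1=[n]$ and $U_2=\bigcup_{t=1}^m E_t$, where $E_t=\{e_t^1,\dots,e_t^{k/2}\}$ are pairwise disjoint sets of new symbols, and let $\hat K_{n,n}$ be obtained by deleting all edges between $V_t$ and $E_t$ for each $t\in[m]$. Choose a perfect matching $\hat M$ of $\hat K_{n,n}$, let $W_t\subseteq[n]$ be the set of vertices matched to $E_t$ in $\hat M$, with the requirement that whenever $W_t=V_s$ for some $s\neq t$, one has $W_s\neq V_t$; the resulting hypergraph has vertex set $[n]$ and edges $e_t=V_t\cup W_t$, $t\in[m]$.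
   Context: A hypergraph has a finite vertex set and an edge set of distinct nonempty subsets (no multiple edges), with no isolated vertices; it is $k$-uniform if every edge has $k$ vertices and $2$-regular if every vertex lies in exactly two edges. -}

module Defs where

open import Data.Nat using (ℕ; zero; suc; _*_; _<_)
open import Data.Bool using (Bool; true; false)
open import Data.Fin using (Fin; quotient)
open import Data.Fin.Properties using (_≟_)
open import Data.Fin.Subset using (Subset; _∈_; ∣_∣; _∪_; ⊥)
open import Data.Vec using (tabulate; lookup)
open import Data.Product using (Σ; ∃; _×_; _,_; proj₁)
open import Function.Bundles using (_↔_; Inverse; _⇔_)
open import Function.Definitions using (Injective)
open import Relation.Binary.PropositionalEquality using (_≡_; _≢_)
open import Relation.Nullary.Decidable using (⌊_⌋)

EdgeFamily : ℕ → ℕ → Set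
EdgeFamily n m = Fin m → Subset n

edgesAt : ∀ {n m} → EdgeFamily n m → Fin n → Subset m
edgesAt G v = tabulate (λ i → lookup (G i) v)

degree : ∀ {n m} → EdgeFamily n m → Fin n → ℕ
degree G v = ∣ edgesAt G v ∣

IsHypergraph : ∀ {n m} → EdgeFamily n m → Set
IsHypergraph {n} {m} G =
  Injective _≡_ _≡_ G × (∀ i → G i ≢ ⊥) × (∀ (v : Fin n) → ∃ λ i → v ∈ G i)

Uniform : ∀ {n m} → ℕ → EdgeFamily n m → Set
Uniform k G = ∀ i → ∣ G i ∣ ≡ k

TwoRegular : ∀ {n m} → EdgeFamily n m → Set
TwoRegular G = ∀ v → degree G v ≡ 2

Isomorphic : ∀ {n n' m} → EdgeFamily n m → EdgeFamily n' m → Set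
Isomorphic {n} {n'} {m} G H =
  Σ (Fin n ↔ Fin n') λ φ → Σ (Fin m ↔ Fin m) λ ψ →
    ∀ i v → (v ∈ G i) ⇔ (Inverse.to φ v ∈ H (Inverse.to ψ i))

-- The construction, with h = k/2 and n = m * h.
-- [n] is Fin (m * h) (0-indexed); block t is
-- V_t = {h t, …, h t + h - 1} = { v | quotient h v ≡ t }.
-- U₂ = ⋃ E_t with E_t = {e_t^1..e_t^h} is represented by Fin m × Fin h,
-- e_t^j ↦ (t , j).

V : ∀ {m} h → Fin m → Subset (m * h)
V h t = tabulate (λ v → ⌊ quotient h v ≟ t ⌋)

-- A perfect matching of K̂_{n,n}: a bijection U₂ → U₁ (each symbol matched
-- to exactly one vertex, each vertex to exactly one symbol) that uses no
-- deleted edge, i.e. e_t^j is not matched into V_t.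
record PerfectMatching (m h : ℕ) : Set where
  field
    match     : (Fin m × Fin h) ↔ Fin (m * h)
    avoids    : ∀ t j → quotient h (Inverse.to match (t , j)) ≢ t

W : ∀ {m h} → PerfectMatching m h → Fin m → Subset (m * h)
W M t = tabulate (λ v → ⌊ proj₁ (Inverse.from (PerfectMatching.match M) v) ≟ t ⌋)

Admissible : ∀ {m h} → PerfectMatching m h → Set
Admissible {m} {h} M = ∀ (s t : Fin m) → s ≢ t → W M t ≡ V h s → W M s ≢ V h t

construction : ∀ {m h} → PerfectMatching m h → EdgeFamily (m * h) m
construction {m} {h} M t = V h t ∪ W M t

-- Every vertex v of G lies in exactly two edges a ≠ b, so G is the line graph of the
-- loopless multigraph on the edge indices having one edge {a, b} for each vertex v.
-- Since G is k-uniform this multigraph is k-regular with k = 2h even, so by Euler's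
-- argument it has an orientation in which every in- and out-degree equals h. Putting
-- the h arcs leaving t into the block V_t and matching the symbols of E_t to the h arcs
-- entering t gives a perfect matching of K̂_{n,n} (no arc is a loop) for which
-- V_t ∪ W_t consists of the arcs at t, i.e. of the vertices of the t-th edge of G.
-- If W_t = V_s and W_s = V_t then the edges s and t of G coincide, which is excluded
-- since a hypergraph has no multiple edges.

module Submission where

open import Defs
open import Data.Bool using (Bool; true; false; if_then_else_)
open import Data.Bool.Properties using (T-≡)
open import Data.Fin using (Fin; zero; suc; cast; quotient)
open import Data.Fin.Properties using (_≟_; cast-involutive; *↔×; remQuot-combine)
import Data.Fin.Properties as Fin
open import Data.Fin.Subset using (Subset; inside; outside; _∈_; ∣_∣; _∪_; ⊥; ⁅_⁆)
open import Data.Fin.Subset.Properties using (∪-identityˡ; ∪-comm; ∪⇔⊎; x∈⁅y⁆⇔x≡y; ⊆-antisym)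
open import Data.List as List using (List; []; _∷_; _++_; map; length)
open import Data.List.Properties using (map-++; map-∘; map-tabulate; length-++-sucʳ)
open import Data.List.Relation.Binary.Pointwise using (Pointwise; []; _∷_; ++⁺)
import Data.List.Relation.Binary.Pointwise as Pointwise
open import Data.Nat using (ℕ; zero; suc; _+_; _*_; _<_; s≤s)
open import Data.Nat.Divisibility using (_∣_; ∣m+n∣m⇒∣n; m∣m*n; ∣1⇒≡1)
open import Data.Nat.Induction using (<-wellFounded)
open import Data.Nat.ListAction using (sum)
open import Data.Nat.ListAction.Properties using (sum-++)
open import Data.Nat.Properties using (suc-injective; ≤-refl; ≤-reflexive; +-assoc; +-comm; *-cancelˡ-≡)
open import Data.Nat.Tactic.RingSolver using (solve-∀)
open import Data.Product using (Σ; _×_; _,_; proj₁; proj₂; swap; ∃; ∃₂)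
open import Data.Sum using (_⊎_; inj₁; inj₂)
import Data.Sum as Sum
open import Data.Sum.Function.Propositional using (_⊎-⇔_)
open import Data.Vec using (_∷_; []; lookup; tabulate; here; there)
open import Data.Vec.Properties using ([]=⇒lookup; lookup⇒[]=; lookup∘tabulate)
open import Function using (_∘_; _on_)
open import Function.Bundles using (_↔_; _⇔_; mk↔ₛ′; mk⇔; Inverse; Equivalence)
open import Function.Construct.Composition using (_↔-∘_)
open import Function.Construct.Identity using (↔-id)
open import Function.Construct.Symmetry using (↔-sym)
open import Function.Definitions using (Injective)
import Function.Properties.Equivalence as ⇔
open import Induction.WellFounded using (Acc; acc)
import Relation.Binary.Construct.On as On
open import Relation.Binary.Definitions using (DecidableEquality)
open import Relation.Binary.PropositionalEquality
open import Relation.Nullary using (yes; no; ¬_; contradiction)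
open import Relation.Nullary.Decidable using (⌊_⌋; toWitness; fromWitness)

private variable
  n m : ℕ

𝟙 : Bool → ℕ
𝟙 b = if b then 1 else 0

∈-tabulate⇔ : {f : Fin n → Bool} {x : Fin n} → x ∈ tabulate f ⇔ f x ≡ true
∈-tabulate⇔ {f = f} {x} = mk⇔
  (λ x∈ → trans (sym (lookup∘tabulate f x)) ([]=⇒lookup x∈))
  (λ fx → lookup⇒[]= x (tabulate f) (trans (lookup∘tabulate f x) fx))

∈-lookup⇔ : {p : Subset n} {x : Fin n} → x ∈ p ⇔ lookup p x ≡ true
∈-lookup⇔ {p = p} {x} = mk⇔ []=⇒lookup (lookup⇒[]= x p)

∣p∣≡0⇒p≡⊥ : (p : Subset n) → ∣ p ∣ ≡ 0 → p ≡ ⊥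
∣p∣≡0⇒p≡⊥ []            _     = refl
∣p∣≡0⇒p≡⊥ (outside ∷ p) ∣p∣≡0 = cong (outside ∷_) (∣p∣≡0⇒p≡⊥ p ∣p∣≡0)

∣p∣≡1⇒p≡⁅x⁆ : (p : Subset n) → ∣ p ∣ ≡ 1 → ∃ λ x → p ≡ ⁅ x ⁆
∣p∣≡1⇒p≡⁅x⁆ (inside  ∷ p) ∣p∣≡1 = zero , cong (inside ∷_) (∣p∣≡0⇒p≡⊥ p (suc-injective ∣p∣≡1))
∣p∣≡1⇒p≡⁅x⁆ (outside ∷ p) ∣p∣≡1 with x , refl ← ∣p∣≡1⇒p≡⁅x⁆ p ∣p∣≡1 = suc x , refl

∣p∣≡2⇒p≡⁅x⁆∪⁅y⁆ : (p : Subset n) → ∣ p ∣ ≡ 2 → ∃₂ λ x y → x ≢ y × p ≡ ⁅ x ⁆ ∪ ⁅ y ⁆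
∣p∣≡2⇒p≡⁅x⁆∪⁅y⁆ (inside ∷ p) ∣p∣≡2 with y , refl ← ∣p∣≡1⇒p≡⁅x⁆ p (suc-injective ∣p∣≡2) =
  zero , suc y , (λ ()) , cong (inside ∷_) (sym (∪-identityˡ ⁅ y ⁆))
∣p∣≡2⇒p≡⁅x⁆∪⁅y⁆ (outside ∷ p) ∣p∣≡2 with x , y , x≢y , refl ← ∣p∣≡2⇒p≡⁅x⁆∪⁅y⁆ p ∣p∣≡2 =
  suc x , suc y , x≢y ∘ Fin.suc-injective , refl

∈⁅x⁆∪⁅y⁆⇔ : {x y z : Fin n} → z ∈ ⁅ x ⁆ ∪ ⁅ y ⁆ ⇔ (x ≡ z ⊎ y ≡ z)
∈⁅x⁆∪⁅y⁆⇔ = ⇔.trans ∪⇔⊎ (∈⁅x⁆⇔ ⊎-⇔ ∈⁅x⁆⇔)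
  where
  ∈⁅x⁆⇔ : {x z : Fin n} → z ∈ ⁅ x ⁆ ⇔ x ≡ z
  ∈⁅x⁆⇔ = ⇔.trans x∈⁅y⁆⇔x≡y (mk⇔ sym sym)

sum-tabulate-𝟙 : (s : Subset n) (w : Fin n → ℕ) → (∀ v → w v ≡ 𝟙 (lookup s v)) →
                 sum (List.tabulate w) ≡ ∣ s ∣
sum-tabulate-𝟙 []            w w≡𝟙 = refl
sum-tabulate-𝟙 (inside  ∷ s) w w≡𝟙 = cong₂ _+_ (w≡𝟙 zero) (sum-tabulate-𝟙 s (w ∘ suc) (w≡𝟙 ∘ suc))
sum-tabulate-𝟙 (outside ∷ s) w w≡𝟙 = cong₂ _+_ (w≡𝟙 zero) (sum-tabulate-𝟙 s (w ∘ suc) (w≡𝟙 ∘ suc))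

sum-tabulate-+ : (f g : Fin n → ℕ) →
                 sum (List.tabulate (λ v → f v + g v)) ≡ sum (List.tabulate f) + sum (List.tabulate g)
sum-tabulate-+ {zero}  f g = refl
sum-tabulate-+ {suc n} f g =
  trans (cong (f zero + g zero +_) (sum-tabulate-+ (f ∘ suc) (g ∘ suc))) (shuffle (f zero) (g zero) _ _)
  where
  shuffle : ∀ a b c d → a + b + (c + d) ≡ a + c + (b + d)
  shuffle = solve-∀

sum-map-++ : ∀ {a} {A : Set a} (w : A → ℕ) (P Q : List A) →
             sum (map w (P ++ Q)) ≡ sum (map w P) + sum (map w Q)
sum-map-++ w P Q = trans (cong sum (map-++ w P Q)) (sum-++ (map w P) (map w Q))

sum-map-∷-++-∷ : ∀ {a} {A : Set a} (w : A → ℕ) (u v : A) (P Q : List A) →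
                 sum (map w (u ∷ P ++ v ∷ Q)) ≡ w u + w v + sum (map w (P ++ Q))
sum-map-∷-++-∷ w u v P Q = begin
  w u + sum (map w (P ++ v ∷ Q))                  ≡⟨ cong (w u +_) (sum-map-++ w P (v ∷ Q)) ⟩
  w u + (sum (map w P) + (w v + sum (map w Q)))   ≡⟨ shuffle (w u) (w v) (sum (map w P)) (sum (map w Q)) ⟩
  w u + w v + (sum (map w P) + sum (map w Q))     ≡⟨ cong (w u + w v +_) (sum-map-++ w P Q) ⟨
  w u + w v + sum (map w (P ++ Q))                ∎
  where
  open ≡-Reasoning
  shuffle : ∀ a b c d → a + (c + (b + d)) ≡ a + b + (c + d)
  shuffle = solve-∀

Pointwise-++⁻ : ∀ {a b ℓ} {A : Set a} {B : Set b} {R : A → B → Set ℓ} (xs : List A) {ys zs} →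
                Pointwise R (xs ++ ys) zs →
                ∃₂ λ zs₁ zs₂ → zs ≡ zs₁ ++ zs₂ × Pointwise R xs zs₁ × Pointwise R ys zs₂
Pointwise-++⁻ []       xsys∼zs        = [] , _ , refl , [] , xsys∼zs
Pointwise-++⁻ (_ ∷ xs) (x∼z ∷ xsys∼zs)
  with zs₁ , zs₂ , refl , xs∼zs₁ , ys∼zs₂ ← Pointwise-++⁻ xs xsys∼zs =
  _ ∷ zs₁ , zs₂ , refl , x∼z ∷ xs∼zs₁ , ys∼zs₂

Pointwise-tabulate⁻ : ∀ {a b ℓ} {A : Set a} {B : Set b} {R : A → B → Set ℓ} (f : Fin n → A) {ys} →
                      Pointwise R (List.tabulate f) ys →
                      ∃ λ g → ys ≡ List.tabulate g × (∀ i → R (f i) (g i))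
Pointwise-tabulate⁻ {zero}  f []            = (λ ()) , refl , λ ()
Pointwise-tabulate⁻ {suc n} f (r ∷ rs) with g , refl , gs ← Pointwise-tabulate⁻ (f ∘ suc) rs =
  (λ { zero → _ ; (suc i) → g i }) , refl , λ { zero → r ; (suc i) → gs i }

-- V h t and W M t are, definitionally, fibres of quotient h and of the matching.
fibre : (Fin n → Fin m) → Fin m → Subset n
fibre f t = tabulate (λ v → ⌊ f v ≟ t ⌋)

∈-fibre⇔ : {f : Fin n → Fin m} {t : Fin m} {v : Fin n} → v ∈ fibre f t ⇔ f v ≡ t
∈-fibre⇔ {f = f} {t} {v} =
  ⇔.trans ∈-tabulate⇔
    (mk⇔ (toWitness {a? = f v ≟ t} ∘ Equivalence.from T-≡) (Equivalence.to T-≡ ∘ fromWitness))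

enumerate : (p : Subset n) → Fin ∣ p ∣ → Fin n
enumerate (inside  ∷ p) zero    = zero
enumerate (inside  ∷ p) (suc i) = suc (enumerate p i)
enumerate (outside ∷ p) i       = suc (enumerate p i)

enumerate-∈ : (p : Subset n) (i : Fin ∣ p ∣) → enumerate p i ∈ p
enumerate-∈ (inside  ∷ p) zero    = here
enumerate-∈ (inside  ∷ p) (suc i) = there (enumerate-∈ p i)
enumerate-∈ (outside ∷ p) i       = there (enumerate-∈ p i)

rank : (p : Subset n) {x : Fin n} → x ∈ p → Fin ∣ p ∣
rank (inside  ∷ p) here        = zero
rank (inside  ∷ p) (there x∈p) = suc (rank p x∈p)
rank (outside ∷ p) (there x∈p) = rank p x∈p

rank-irrelevant : (p : Subset n) {x : Fin n} (x∈p x∈p′ : x ∈ p) → rank p x∈p ≡ rank p x∈p′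
rank-irrelevant (inside  ∷ p) here        here         = refl
rank-irrelevant (inside  ∷ p) (there x∈p) (there x∈p′) = cong suc (rank-irrelevant p x∈p x∈p′)
rank-irrelevant (outside ∷ p) (there x∈p) (there x∈p′) = rank-irrelevant p x∈p x∈p′

enumerate-rank : (p : Subset n) {x : Fin n} (x∈p : x ∈ p) → enumerate p (rank p x∈p) ≡ x
enumerate-rank (inside  ∷ p) here        = refl
enumerate-rank (inside  ∷ p) (there x∈p) = cong suc (enumerate-rank p x∈p)
enumerate-rank (outside ∷ p) (there x∈p) = cong suc (enumerate-rank p x∈p)

rank-enumerate : (p : Subset n) (i : Fin ∣ p ∣) → rank p (enumerate-∈ p i) ≡ i
rank-enumerate (inside  ∷ p) zero    = refl
rank-enumerate (inside  ∷ p) (suc i) = cong suc (rank-enumerate p i)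
rank-enumerate (outside ∷ p) i       = rank-enumerate p i

module _ (f : Fin n → Fin m) {h : ℕ} (∣fibre∣≡h : ∀ t → ∣ fibre f t ∣ ≡ h) where

  private
    position : ∀ {t v} → v ∈ fibre f t → Fin h
    position {t} v∈ = cast (∣fibre∣≡h t) (rank (fibre f t) v∈)

    ∈-own-fibre : ∀ v → v ∈ fibre f (f v)
    ∈-own-fibre v = Equivalence.from ∈-fibre⇔ refl

    locate : Fin n → Fin m × Fin h
    locate v = f v , position (∈-own-fibre v)

    select : Fin m × Fin h → Fin n
    select (t , j) = enumerate (fibre f t) (cast (sym (∣fibre∣≡h t)) j)

    locate-∈ : ∀ {t v} (v∈ : v ∈ fibre f t) → locate v ≡ (t , position v∈)
    locate-∈ {v = v} v∈ = via (Equivalence.to ∈-fibre⇔ v∈) v∈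
      where
      via : ∀ {t} → f v ≡ t → (v∈ : v ∈ fibre f t) → locate v ≡ (t , position v∈)
      via refl v∈ = cong (λ r → f v , cast (∣fibre∣≡h (f v)) r) (rank-irrelevant _ (∈-own-fibre v) v∈)

    locate-select : ∀ y → locate (select y) ≡ y
    locate-select (t , j) = begin
      locate (enumerate (fibre f t) i)
        ≡⟨ locate-∈ (enumerate-∈ (fibre f t) i) ⟩
      t , cast eq (rank (fibre f t) (enumerate-∈ (fibre f t) i))
        ≡⟨ cong (λ r → t , cast eq r) (rank-enumerate (fibre f t) i) ⟩
      t , cast eq i
        ≡⟨ cong (t ,_) (cast-involutive eq (sym eq) j) ⟩
      t , j
        ∎
      where
      open ≡-Reasoning
      eq : ∣ fibre f t ∣ ≡ h
      eq = ∣fibre∣≡h t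
      i : Fin ∣ fibre f t ∣
      i = cast (sym eq) j

    select-locate : ∀ v → select (locate v) ≡ v
    select-locate v = begin
      enumerate (fibre f (f v)) (cast (sym eq) (cast eq r))
        ≡⟨ cong (enumerate (fibre f (f v))) (cast-involutive (sym eq) eq r) ⟩
      enumerate (fibre f (f v)) r
        ≡⟨ enumerate-rank (fibre f (f v)) (∈-own-fibre v) ⟩
      v
        ∎
      where
      open ≡-Reasoning
      eq : ∣ fibre f (f v) ∣ ≡ h
      eq = ∣fibre∣≡h (f v)
      r : Fin ∣ fibre f (f v) ∣
      r = rank (fibre f (f v)) (∈-own-fibre v)

  equalFibres↔ : Fin n ↔ (Fin m × Fin h)
  equalFibres↔ = mk↔ₛ′ locate select locate-select select-locate

  proj₁-equalFibres↔ : ∀ v → proj₁ (Inverse.to equalFibres↔ v) ≡ f v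
  proj₁-equalFibres↔ v = refl

module Orientation {a} {A : Set a} (_≟_ : DecidableEquality A) where

  Arc : Set a
  Arc = A × A

  [_≐_] : A → A → ℕ
  [ x ≐ t ] = 𝟙 ⌊ x ≟ t ⌋

  [≐]-refl : ∀ t → [ t ≐ t ] ≡ 1
  [≐]-refl t with t ≟ t
  ... | yes _   = refl
  ... | no t≢t = contradiction refl t≢t

  [≐]-≢ : ∀ {x t} → x ≢ t → [ x ≐ t ] ≡ 0
  [≐]-≢ {x} {t} x≢t with x ≟ t
  ... | yes x≡t = contradiction x≡t x≢t
  ... | no _    = refl

  outdeg indeg deg : A → List Arc → ℕ
  outdeg t L = sum (map (λ e → [ proj₁ e ≐ t ]) L)
  indeg  t L = sum (map (λ e → [ proj₂ e ≐ t ]) L)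
  deg t L = outdeg t L + indeg t L

  Balanced : List Arc → Set a
  Balanced L = ∀ t → outdeg t L ≡ indeg t L

  EvenDegrees : List Arc → Set a
  EvenDegrees L = ∀ t → 2 ∣ deg t L

  infix 4 _⇄_
  _⇄_ : Arc → Arc → Set a
  u ⇄ v = v ≡ u ⊎ v ≡ swap u

  Incident : A → Arc → Set a
  Incident t u = proj₁ u ≡ t ⊎ proj₂ u ≡ t

  ⇄-incident : ∀ {t u v} → u ⇄ v → Incident t u ⇔ Incident t v
  ⇄-incident (inj₁ refl) = ⇔.refl
  ⇄-incident (inj₂ refl) = mk⇔ Sum.swap Sum.swap

  ⇄-loopless : ∀ {u v} → u ⇄ v → proj₁ u ≢ proj₂ u → proj₁ v ≢ proj₂ v
  ⇄-loopless (inj₁ refl) u-loopless = u-loopless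
  ⇄-loopless (inj₂ refl) u-loopless = u-loopless ∘ sym

  ⇄-refl : ∀ {u} → u ⇄ u
  ⇄-refl = inj₁ refl

  ⇄-swap : ∀ {u v} → u ⇄ v → u ⇄ swap v
  ⇄-swap (inj₁ refl) = inj₂ refl
  ⇄-swap (inj₂ refl) = inj₁ refl

  deg-∷ : ∀ t x y L → deg t ((x , y) ∷ L) ≡ [ x ≐ t ] + [ y ≐ t ] + deg t L
  deg-∷ t x y L = shuffle [ x ≐ t ] [ y ≐ t ] (outdeg t L) (indeg t L)
    where
    shuffle : ∀ a b c d → a + c + (b + d) ≡ a + b + (c + d)
    shuffle = solve-∀

  deg-⇄ : ∀ t {L L′} → Pointwise _⇄_ L L′ → deg t L ≡ deg t L′
  deg-⇄ t []                         = refl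
  deg-⇄ t {(x , y) ∷ L} {_ ∷ L′} (inj₁ refl ∷ L⇄L′) =
    trans (deg-∷ t x y L) (trans (cong ([ x ≐ t ] + [ y ≐ t ] +_) (deg-⇄ t L⇄L′)) (sym (deg-∷ t x y L′)))
  deg-⇄ t {(x , y) ∷ L} {_ ∷ L′} (inj₂ refl ∷ L⇄L′) = begin
    deg t ((x , y) ∷ L)                 ≡⟨ deg-∷ t x y L ⟩
    [ x ≐ t ] + [ y ≐ t ] + deg t L     ≡⟨ cong₂ _+_ (+-comm [ x ≐ t ] [ y ≐ t ]) (deg-⇄ t L⇄L′) ⟩
    [ y ≐ t ] + [ x ≐ t ] + deg t L′    ≡⟨ deg-∷ t y x L′ ⟨
    deg t ((y , x) ∷ L′)                ∎
    where open ≡-Reasoning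

  outdeg-detour : ∀ t x y z P Q →
                  outdeg t ((x , y) ∷ P ++ (y , z) ∷ Q) ≡ [ y ≐ t ] + outdeg t ((x , z) ∷ P ++ Q)
  outdeg-detour t x y z P Q =
    trans (sum-map-∷-++-∷ _ (x , y) (y , z) P Q) (shuffle [ x ≐ t ] [ y ≐ t ] (outdeg t (P ++ Q)))
    where
    shuffle : ∀ a b c → a + b + c ≡ b + (a + c)
    shuffle = solve-∀

  indeg-detour : ∀ t x y z P Q →
                 indeg t ((x , y) ∷ P ++ (y , z) ∷ Q) ≡ [ y ≐ t ] + indeg t ((x , z) ∷ P ++ Q)
  indeg-detour t x y z P Q =
    trans (sum-map-∷-++-∷ _ (x , y) (y , z) P Q) (+-assoc [ y ≐ t ] [ z ≐ t ] (indeg t (P ++ Q)))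

  detour-balanced : ∀ {x y z P Q} → Balanced ((x , z) ∷ P ++ Q) → Balanced ((x , y) ∷ P ++ (y , z) ∷ Q)
  detour-balanced {x} {y} {z} {P} {Q} bal t = begin
    outdeg t ((x , y) ∷ P ++ (y , z) ∷ Q) ≡⟨ outdeg-detour t x y z P Q ⟩
    [ y ≐ t ] + outdeg t ((x , z) ∷ P ++ Q) ≡⟨ cong ([ y ≐ t ] +_) (bal t) ⟩
    [ y ≐ t ] + indeg t ((x , z) ∷ P ++ Q) ≡⟨ indeg-detour t x y z P Q ⟨
    indeg t ((x , y) ∷ P ++ (y , z) ∷ Q)  ∎
    where open ≡-Reasoning

  merge-even : ∀ {x y z e P Q} → e ⇄ (y , z) →
               EvenDegrees ((x , y) ∷ P ++ e ∷ Q) → EvenDegrees ((x , z) ∷ P ++ Q)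
  merge-even {x} {y} {z} {e} {P} {Q} e⇄yz even t =
    ∣m+n∣m⇒∣n (subst (2 ∣_) merged (even t)) (m∣m*n [ y ≐ t ])
    where
    merged : deg t ((x , y) ∷ P ++ e ∷ Q) ≡ 2 * [ y ≐ t ] + deg t ((x , z) ∷ P ++ Q)
    merged = begin
      deg t ((x , y) ∷ P ++ e ∷ Q)
        ≡⟨ deg-⇄ t (⇄-refl ∷ ++⁺ (Pointwise.refl ⇄-refl {P}) (e⇄yz ∷ Pointwise.refl ⇄-refl {Q})) ⟩
      deg t ((x , y) ∷ P ++ (y , z) ∷ Q)
        ≡⟨ cong₂ _+_ (outdeg-detour t x y z P Q) (indeg-detour t x y z P Q) ⟩
      [ y ≐ t ] + outdeg t R + ([ y ≐ t ] + indeg t R)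
        ≡⟨ shuffle [ y ≐ t ] (outdeg t R) (indeg t R) ⟩
      2 * [ y ≐ t ] + deg t R
        ∎
      where
      open ≡-Reasoning
      R : List Arc
      R = (x , z) ∷ P ++ Q
      shuffle : ∀ a b c → a + b + (a + c) ≡ 2 * a + (b + c)
      shuffle = solve-∀

  arc-at : ∀ y L → deg y L ≢ 0 →
           ∃₂ λ P Q → ∃₂ λ e z → L ≡ P ++ e ∷ Q × e ⇄ (y , z)
  arc-at y [] deg≢0 = contradiction refl deg≢0
  arc-at y ((a , b) ∷ L) deg≢0 with a ≟ y | b ≟ y
  ... | yes refl | _        = [] , L , (a , b) , b , refl , inj₁ refl
  ... | no _     | yes refl = [] , L , (a , b) , a , refl , inj₂ refl
  ... | no a≢y   | no b≢y   with P , Q , e , z , refl , e⇄yz ← arc-at y L deg≢0 =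
    (a , b) ∷ P , Q , e , z , refl , e⇄yz

  outdeg-reverse : ∀ t L → outdeg t (map swap L) ≡ indeg t L
  outdeg-reverse t L = cong sum (sym (map-∘ L))

  indeg-reverse : ∀ t L → indeg t (map swap L) ≡ outdeg t L
  indeg-reverse t L = cong sum (sym (map-∘ L))

  reverse-balanced : ∀ {L} → Balanced L → Balanced (map swap L)
  reverse-balanced {L} bal t =
    trans (outdeg-reverse t L) (trans (sym (bal t)) (sym (indeg-reverse t L)))

  reverse-reorientation : ∀ {L L′} → Pointwise _⇄_ L L′ → Pointwise _⇄_ L (map swap L′)
  reverse-reorientation []                 = []
  reverse-reorientation (u⇄v ∷ L⇄L′) = ⇄-swap u⇄v ∷ reverse-reorientation L⇄L′

  BalancedReorientation : List Arc → Set a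
  BalancedReorientation L = ∃ λ L′ → Pointwise _⇄_ L L′ × Balanced L′

  -- Reversing every arc preserves balance, so one arc may keep its given direction.
  fix-head : ∀ {u L} → BalancedReorientation (u ∷ L) → ∃ λ L′ → Pointwise _⇄_ L L′ × Balanced (u ∷ L′)
  fix-head (_ ∷ L′ , inj₁ refl ∷ L⇄L′ , bal) = L′ , L⇄L′ , bal
  fix-head (_ ∷ L′ , inj₂ refl ∷ L⇄L′ , bal) =
    map swap L′ , reverse-reorientation L⇄L′ , reverse-balanced {_ ∷ L′} bal

  loop-even : ∀ {x L} → EvenDegrees ((x , x) ∷ L) → EvenDegrees L
  loop-even {x} {L} even t =
    ∣m+n∣m⇒∣n (subst (2 ∣_) (trans (deg-∷ t x x L) (cong (_+ deg t L) (double [ x ≐ t ]))) (even t))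
              (m∣m*n [ x ≐ t ])
    where
    double : ∀ a → a + a ≡ 2 * a
    double = solve-∀

  odd-after-head : ∀ {x y L} → x ≢ y → EvenDegrees ((x , y) ∷ L) → deg y L ≢ 0
  odd-after-head {x} {y} {L} x≢y even deg≡0 = contradiction (∣1⇒≡1 2∣1) λ ()
    where
    2∣1 : 2 ∣ 1
    2∣1 = subst (2 ∣_) (begin
      deg y ((x , y) ∷ L)              ≡⟨ deg-∷ y x y L ⟩
      [ x ≐ y ] + [ y ≐ y ] + deg y L  ≡⟨ cong₂ _+_ (cong₂ _+_ ([≐]-≢ x≢y) ([≐]-refl y)) deg≡0 ⟩
      1                                   ∎) (even y)
      where open ≡-Reasoning

  -- Euler's argument: if x ≠ y then y has odd degree in L, so L has an arc e at y, say
  -- with other end z; replace (x , y) and e by the shortcut (x , z), orient the shorter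
  -- list, and put the path x → y → z back in place of the oriented shortcut.
  reorient : ∀ L → Acc (_<_ on length) L → EvenDegrees L → BalancedReorientation L
  reorient [] _ _ = [] , [] , λ _ → refl
  reorient ((x , y) ∷ L) (acc rec) even with x ≟ y
  ... | yes refl with L′ , L⇄L′ , bal ← reorient L (rec ≤-refl) (loop-even {L = L} even) =
    (x , x) ∷ L′ , ⇄-refl ∷ L⇄L′ , λ t → cong ([ x ≐ t ] +_) (bal t)
  ... | no x≢y
    with P , Q , e , z , refl , e⇄yz ← arc-at y L (odd-after-head {L = L} x≢y even)
    with M , PQ⇄M , bal ← fix-head (reorient ((x , z) ∷ P ++ Q)
                                             (rec (s≤s (≤-reflexive (sym (length-++-sucʳ P e Q)))))
                                             (merge-even {P = P} {Q} e⇄yz even))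
    with M₁ , M₂ , refl , P⇄M₁ , Q⇄M₂ ← Pointwise-++⁻ P PQ⇄M =
    (x , y) ∷ M₁ ++ (y , z) ∷ M₂ , ⇄-refl ∷ ++⁺ P⇄M₁ (e⇄yz ∷ Q⇄M₂) , detour-balanced {P = M₁} {M₂} bal

  even⇒balancedReorientation : ∀ L → EvenDegrees L → BalancedReorientation L
  even⇒balancedReorientation L = reorient L (On.wellFounded length <-wellFounded L)

module _ {m : ℕ} where

  open Orientation (_≟_ {m})

  outdeg-tabulate : ∀ t (q : Fin n → Fin m × Fin m) → outdeg t (List.tabulate q) ≡ ∣ fibre (proj₁ ∘ q) t ∣
  outdeg-tabulate t q = trans (cong sum (map-tabulate q _))
    (sum-tabulate-𝟙 (fibre (proj₁ ∘ q) t) _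
      λ v → cong 𝟙 (sym (lookup∘tabulate (λ v → ⌊ proj₁ (q v) ≟ t ⌋) v)))

  indeg-tabulate : ∀ t (q : Fin n → Fin m × Fin m) → indeg t (List.tabulate q) ≡ ∣ fibre (proj₂ ∘ q) t ∣
  indeg-tabulate t q = trans (cong sum (map-tabulate q _))
    (sum-tabulate-𝟙 (fibre (proj₂ ∘ q) t) _
      λ v → cong 𝟙 (sym (lookup∘tabulate (λ v → ⌊ proj₂ (q v) ≟ t ⌋) v)))

∈-edgesAt⇔ : (G : EdgeFamily n m) {v : Fin n} {t : Fin m} → t ∈ edgesAt G v ⇔ v ∈ G t
∈-edgesAt⇔ G = ⇔.trans ∈-tabulate⇔ (⇔.sym ∈-lookup⇔)

injective-transport : ∀ {n′} (G : EdgeFamily n m) (H : EdgeFamily n′ m) (φ : Fin n → Fin n′) →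
                      (∀ t v → v ∈ G t ⇔ φ v ∈ H t) → Injective _≡_ _≡_ G → Injective _≡_ _≡_ H
injective-transport G H φ G⇔H G-injective Hs≡Ht =
  G-injective (⊆-antisym (transport Hs≡Ht) (transport (sym Hs≡Ht)))
  where
  transport : ∀ {s t} → H s ≡ H t → ∀ {v} → v ∈ G s → v ∈ G t
  transport {s} {t} Hs≡Ht {v} v∈Gs =
    Equivalence.from (G⇔H t v) (subst (φ v ∈_) Hs≡Ht (Equivalence.to (G⇔H s v) v∈Gs))

module TwoRegularUniform {n m h : ℕ} (G : EdgeFamily n m)
                         (uniform : Uniform (2 * h) G) (regular : TwoRegular G) where

  open Orientation (_≟_ {m})

  private
    edge-pair : ∀ v → ∃₂ λ a b → a ≢ b × edgesAt G v ≡ ⁅ a ⁆ ∪ ⁅ b ⁆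
    edge-pair v = ∣p∣≡2⇒p≡⁅x⁆∪⁅y⁆ (edgesAt G v) (regular v)

  arc : Fin n → Arc
  arc v = proj₁ (edge-pair v) , proj₁ (proj₂ (edge-pair v))

  ∈⇔incident : ∀ {t v} → v ∈ G t ⇔ Incident t (arc v)
  ∈⇔incident {t} {v} =
    ⇔.trans (⇔.sym (∈-edgesAt⇔ G)) (⇔.trans (mk⇔ (subst (t ∈_) eq) (subst (t ∈_) (sym eq))) ∈⁅x⁆∪⁅y⁆⇔)
    where
    eq : edgesAt G v ≡ ⁅ proj₁ (arc v) ⁆ ∪ ⁅ proj₂ (arc v) ⁆
    eq = proj₂ (proj₂ (proj₂ (edge-pair v)))

  arc-loopless : ∀ v → proj₁ (arc v) ≢ proj₂ (arc v)
  arc-loopless v = proj₁ (proj₂ (proj₂ (edge-pair v)))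

  arc-incidence : ∀ t v → [ proj₁ (arc v) ≐ t ] + [ proj₂ (arc v) ≐ t ] ≡ 𝟙 (lookup (G t) v)
  arc-incidence t v with lookup (G t) v in eq
  ... | true with Equivalence.to ∈⇔incident (lookup⇒[]= v (G t) eq)
  ...   | inj₁ refl = cong₂ _+_ ([≐]-refl _) ([≐]-≢ (arc-loopless v ∘ sym))
  ...   | inj₂ refl = cong₂ _+_ ([≐]-≢ (arc-loopless v)) ([≐]-refl _)
  arc-incidence t v | false = cong₂ _+_ ([≐]-≢ (v∉ ∘ Equivalence.from ∈⇔incident ∘ inj₁))
                                    ([≐]-≢ (v∉ ∘ Equivalence.from ∈⇔incident ∘ inj₂))
    where
    v∉ : ¬ v ∈ G t
    v∉ v∈ = contradiction (trans (sym ([]=⇒lookup v∈)) eq) λ ()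

  dual : List Arc
  dual = List.tabulate arc

  deg-dual : ∀ t → deg t dual ≡ 2 * h
  deg-dual t = begin
    outdeg t dual + indeg t dual
      ≡⟨ cong₂ _+_ (cong sum (map-tabulate arc _)) (cong sum (map-tabulate arc _)) ⟩
    sum (List.tabulate (λ v → [ proj₁ (arc v) ≐ t ])) + sum (List.tabulate (λ v → [ proj₂ (arc v) ≐ t ]))
      ≡⟨ sum-tabulate-+ (λ v → [ proj₁ (arc v) ≐ t ]) (λ v → [ proj₂ (arc v) ≐ t ]) ⟨
    sum (List.tabulate (λ v → [ proj₁ (arc v) ≐ t ] + [ proj₂ (arc v) ≐ t ]))
      ≡⟨ sum-tabulate-𝟙 (G t) _ (arc-incidence t) ⟩
    ∣ G t ∣
      ≡⟨ uniform t ⟩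
    2 * h
      ∎
    where open ≡-Reasoning

  private
    balancedReorientation : BalancedReorientation dual
    balancedReorientation =
      even⇒balancedReorientation dual λ t → subst (2 ∣_) (sym (deg-dual t)) (m∣m*n h)

    tabulated : ∃ λ q → proj₁ balancedReorientation ≡ List.tabulate q × (∀ v → arc v ⇄ q v)
    tabulated = Pointwise-tabulate⁻ arc (proj₁ (proj₂ balancedReorientation))

  oriented : Fin n → Arc
  oriented = proj₁ tabulated

  source target : Fin n → Fin m
  source = proj₁ ∘ oriented
  target = proj₂ ∘ oriented

  arc⇄oriented : ∀ v → arc v ⇄ oriented v
  arc⇄oriented = proj₂ (proj₂ tabulated)

  source≢target : ∀ v → source v ≢ target v
  source≢target v = ⇄-loopless (arc⇄oriented v) (arc-loopless v)

  ∈⇔source⊎target : ∀ {t v} → v ∈ G t ⇔ (source v ≡ t ⊎ target v ≡ t)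
  ∈⇔source⊎target {v = v} = ⇔.trans ∈⇔incident (⇄-incident (arc⇄oriented v))

  orientedDual : List Arc
  orientedDual = List.tabulate oriented

  private
    L′≡orientedDual : proj₁ balancedReorientation ≡ orientedDual
    L′≡orientedDual = proj₁ (proj₂ tabulated)

  orientedDual-balanced : Balanced orientedDual
  orientedDual-balanced = subst Balanced L′≡orientedDual (proj₂ (proj₂ balancedReorientation))

  outdeg-orientedDual : ∀ t → outdeg t orientedDual ≡ h
  outdeg-orientedDual t = *-cancelˡ-≡ (outdeg t orientedDual) h 2 (begin
    2 * outdeg t orientedDual
      ≡⟨ double (outdeg t orientedDual) ⟩
    outdeg t orientedDual + outdeg t orientedDual
      ≡⟨ cong (outdeg t orientedDual +_) (orientedDual-balanced t) ⟩
    deg t orientedDual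
      ≡⟨ deg-⇄ t dual⇄orientedDual ⟨
    deg t dual
      ≡⟨ deg-dual t ⟩
    2 * h
      ∎)
    where
    open ≡-Reasoning
    double : ∀ a → 2 * a ≡ a + a
    double = solve-∀
    dual⇄orientedDual : Pointwise _⇄_ dual orientedDual
    dual⇄orientedDual = subst (Pointwise _⇄_ dual) L′≡orientedDual (proj₁ (proj₂ balancedReorientation))

  ∣fibre-source∣≡h : ∀ t → ∣ fibre source t ∣ ≡ h
  ∣fibre-source∣≡h t = trans (sym (outdeg-tabulate t oriented)) (outdeg-orientedDual t)

  ∣fibre-target∣≡h : ∀ t → ∣ fibre target t ∣ ≡ h
  ∣fibre-target∣≡h t =
    trans (sym (indeg-tabulate t oriented)) (trans (sym (orientedDual-balanced t)) (outdeg-orientedDual t))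

  private
    byTarget : Fin n ↔ (Fin m × Fin h)
    byTarget = equalFibres↔ target ∣fibre-target∣≡h

  placement : Fin n ↔ Fin (m * h)
  placement = ↔-sym *↔× ↔-∘ equalFibres↔ source ∣fibre-source∣≡h

  quotient-placement : ∀ v → quotient h (Inverse.to placement v) ≡ source v
  quotient-placement v =
    trans (cong proj₁ (remQuot-combine _ _)) (proj₁-equalFibres↔ source ∣fibre-source∣≡h v)

  matching : PerfectMatching m h
  matching = record
    { match  = placement ↔-∘ ↔-sym byTarget
    ; avoids = λ t j → avoids (t , j)
    }
    where
    avoids : ∀ y → quotient h (Inverse.to placement (Inverse.from byTarget y)) ≢ proj₁ y
    avoids y = subst₂ _≢_ (sym (quotient-placement w)) target≡ (source≢target w)
      where
      w : Fin n
      w = Inverse.from byTarget y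
      target≡ : target w ≡ proj₁ y
      target≡ = trans (sym (proj₁-equalFibres↔ target ∣fibre-target∣≡h w))
                      (cong proj₁ (Inverse.strictlyInverseˡ byTarget y))

  ∈V⇔source : ∀ {t v} → Inverse.to placement v ∈ V h t ⇔ source v ≡ t
  ∈V⇔source {v = v} =
    ⇔.trans ∈-fibre⇔ (mk⇔ (trans (sym (quotient-placement v))) (trans (quotient-placement v)))

  ∈W⇔target : ∀ {t v} → Inverse.to placement v ∈ W matching t ⇔ target v ≡ t
  ∈W⇔target {v = v} = ⇔.trans ∈-fibre⇔ (mk⇔ (trans (sym targetOf)) (trans targetOf))
    where
    targetOf : proj₁ (Inverse.to byTarget (Inverse.from placement (Inverse.to placement v))) ≡ target v
    targetOf = trans (proj₁-equalFibres↔ target ∣fibre-target∣≡h _)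
                     (cong target (Inverse.strictlyInverseʳ placement v))

  isomorphic : Isomorphic G (construction matching)
  isomorphic = placement , ↔-id (Fin m) , λ t v →
    ⇔.trans ∈⇔source⊎target (⇔.trans (⇔.sym (∈V⇔source ⊎-⇔ ∈W⇔target)) (⇔.sym ∪⇔⊎))

  admissible : Injective _≡_ _≡_ G → Admissible matching
  admissible G-injective s t s≢t Wt≡Vs Ws≡Vt = s≢t (construction-injective (begin
    V h s ∪ W matching s ≡⟨ cong₂ _∪_ (sym Wt≡Vs) Ws≡Vt ⟩
    W matching t ∪ V h t ≡⟨ ∪-comm (W matching t) (V h t) ⟩
    V h t ∪ W matching t ∎))
    where
    open ≡-Reasoning
    construction-injective : Injective _≡_ _≡_ (construction matching)
    construction-injective =
      injective-transport G (construction matching) (Inverse.to placement)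
                          (proj₂ (proj₂ isomorphic)) G-injective

corollary4p5 : (k h : ℕ) → 2 < k → k ≡ 2 * h →
    (n m : ℕ) → (G : EdgeFamily n m) →
    IsHypergraph G → Uniform k G → TwoRegular G →
    Σ (PerfectMatching m h) λ M → Admissible M × Isomorphic G (construction M)
corollary4p5 _ h _ refl n m G (G-injective , _ , _) uniform regular =
  matching , admissible G-injective , isomorphic
  where open TwoRegularUniform {h = h} G uniform regular
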